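{- The set $\mathbf{Sch}$ of all Schröder partitions (integer partitions in which every odd part has multiplicity $1$), ordered by $\lambda\le\mu$ iff $\lambda$ has at most as many parts as $\mu$ and $\lambda_i\le\mu_i$ for every $i\le$ (number of parts of $\lambda$), is a distributive lattice.
   Context: This order is containment of shapes: it is the restriction of the Young lattice order to Schröder partitions. -}

module Defs where

open import Data.Nat using (ℕ; zero; suc; _+_; _*_; _≤_; _<_)
open import Data.Nat.Properties using (_≟_)
open import Data.List using (List; []; _∷_; length; filter)
open import Data.List.Relation.Unary.All using (All)
open import Data.List.Relation.Unary.Linked using (Linked)
open import Data.Product using (Σ; _×_; proj₁; ∃₂)
open import Relation.Binary.PropositionalEquality using (_≡_)
open import Relation.Binary.Lattice.Structures using (IsDistributiveLattice)
open import Relation.Nullary.Decidable using (⌊_⌋)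

Odd : ℕ → Set
Odd k = Σ ℕ λ m → k ≡ suc (2 * m)

IsPartition : List ℕ → Set
IsPartition λs = Linked (λ a b → b ≤ a) λs × All (λ a → 0 < a) λs

mult : ℕ → List ℕ → ℕ
mult k λs = length (filter (_≟ k) λs)

IsSchroder : List ℕ → Set
IsSchroder λs = IsPartition λs × (∀ k → Odd k → mult k λs ≤ 1)

Sch : Set
Sch = Σ (List ℕ) IsSchroder

-- i-th part (0-indexed), with value 0 beyond the last part.
part : List ℕ → ℕ → ℕ
part []       _       = 0
part (x ∷ _)  zero    = x
part (_ ∷ xs) (suc i) = part xs i

_⊑_ : Sch → Sch → Set
l ⊑ m = (length (proj₁ l) ≤ length (proj₁ m))
      × (∀ i → i < length (proj₁ l) → part (proj₁ l) i ≤ part (proj₁ m) i)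

_≈ˢ_ : Sch → Sch → Set
l ≈ˢ m = proj₁ l ≡ proj₁ m

-- A partition is Schröder exactly when each part b following a part a satisfies
-- b ≤ a, with b < a whenever a is odd. This local condition is preserved by taking
-- componentwise maxima and minima of consecutive pairs, and those are exactly the
-- join (componentwise max, padding the shorter list) and meet (componentwise min,
-- truncating to the shorter list) of Young's lattice. So Sch is a sublattice of
-- Young's lattice, which is distributive because max and min on ℕ distribute.
module Submission where

open import Defs
open import Algebra.Core using (Op₂)
open import Data.Nat using (ℕ; zero; suc; _≤_; _<_; _⊔_; _⊓_; z≤n; s≤s)
open import Data.Nat.Properties
open import Data.List using (List; []; _∷_; length; zipWith)
open import Data.List.Relation.Binary.Pointwise using (Pointwise-≡⇒≡)
open import Data.List.Relation.Binary.Prefix.Heterogeneous using (Prefix; []; _∷_)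
import Data.List.Relation.Binary.Prefix.Heterogeneous.Properties as Prefix
open import Data.List.Properties using (filter-accept; filter-reject; filter-none)
open import Data.List.Relation.Unary.All as All using (All; []; _∷_)
open import Data.List.Relation.Unary.Linked as Linked using (Linked; []; [-]; _∷_)
open import Data.List.Relation.Unary.Linked.Properties using (Linked⇒All)
open import Data.Product using (Σ; ∃₂; _×_; _,_; proj₁; proj₂)
open import Data.Sum using (inj₁; inj₂)
open import Function using (_on_)
open import Level using (Level) renaming (_⊔_ to _⊔ˡ_)
open import Relation.Binary.Core using (Rel)
open import Relation.Binary.Definitions using (Transitive)
open import Relation.Binary.Lattice.Definitions using (Supremum; Infimum)
open import Relation.Binary.Lattice.Structures using (IsDistributiveLattice)
open import Relation.Binary.PropositionalEquality
open import Relation.Binary.Structures using (IsPartialOrder)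
open import Relation.Nullary using (yes; no)
open import Relation.Unary using (Pred)

private
  variable
    a ℓ ℓ′ p : Level

≤-⊔-⊓-isDistributiveLattice : IsDistributiveLattice _≡_ _≤_ _⊔_ _⊓_
≤-⊔-⊓-isDistributiveLattice = record
  { isLattice = record
    { isPartialOrder = ≤-isPartialOrder
    ; supremum       = λ m n → m≤m⊔n m n , m≤n⊔m m n , λ _ → ⊔-lub
    ; infimum        = λ m n → m⊓n≤m m n , m⊓n≤n m n , λ _ → ⊓-glb
    }
  ; ∧-distribˡ-∨ = ⊓-distribˡ-⊔
  }

module ListLattice {A : Set a} {_≤_ : Rel A ℓ} {_∨_ _∧_ : Op₂ A}
                   (L : IsDistributiveLattice _≡_ _≤_ _∨_ _∧_) where

  private
    module L = IsDistributiveLattice L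

  _≼_ : Rel (List A) (a ⊔ˡ ℓ)
  _≼_ = Prefix _≤_

  _∨ᴸ_ : Op₂ (List A)
  []       ∨ᴸ ys       = ys
  (x ∷ xs) ∨ᴸ []       = x ∷ xs
  (x ∷ xs) ∨ᴸ (y ∷ ys) = x ∨ y ∷ xs ∨ᴸ ys

  _∧ᴸ_ : Op₂ (List A)
  _∧ᴸ_ = zipWith _∧_

  ≼-refl : ∀ xs → xs ≼ xs
  ≼-refl []       = []
  ≼-refl (x ∷ xs) = L.refl ∷ ≼-refl xs

  ≼-isPartialOrder : IsPartialOrder _≡_ _≼_
  ≼-isPartialOrder = record
    { isPreorder = record
      { isEquivalence = isEquivalence
      ; reflexive     = λ { {xs} refl → ≼-refl xs }
      ; trans         = Prefix.trans L.trans
      }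
    ; antisym = λ p q → Pointwise-≡⇒≡ (Prefix.antisym L.antisym p q)
    }

  ≼-∨ᴸ-supremum : Supremum _≼_ _∨ᴸ_
  ≼-∨ᴸ-supremum xs ys = upperˡ xs ys , upperʳ xs ys , λ _ → least
    where
    upperˡ : ∀ xs ys → xs ≼ (xs ∨ᴸ ys)
    upperˡ []       ys       = []
    upperˡ (x ∷ xs) []       = ≼-refl (x ∷ xs)
    upperˡ (x ∷ xs) (y ∷ ys) = L.x≤x∨y x y ∷ upperˡ xs ys

    upperʳ : ∀ xs ys → ys ≼ (xs ∨ᴸ ys)
    upperʳ []       ys       = ≼-refl ys
    upperʳ (x ∷ xs) []       = []
    upperʳ (x ∷ xs) (y ∷ ys) = L.y≤x∨y x y ∷ upperʳ xs ys

    least : ∀ {xs ys zs} → xs ≼ zs → ys ≼ zs → (xs ∨ᴸ ys) ≼ zs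
    least []       q        = q
    least (p ∷ ps) []       = p ∷ ps
    least (p ∷ ps) (q ∷ qs) = L.∨-least p q ∷ least ps qs

  ≼-∧ᴸ-infimum : Infimum _≼_ _∧ᴸ_
  ≼-∧ᴸ-infimum xs ys = lowerˡ xs ys , lowerʳ xs ys , λ _ → greatest
    where
    lowerˡ : ∀ xs ys → (xs ∧ᴸ ys) ≼ xs
    lowerˡ []       ys       = []
    lowerˡ (x ∷ xs) []       = []
    lowerˡ (x ∷ xs) (y ∷ ys) = L.x∧y≤x x y ∷ lowerˡ xs ys

    lowerʳ : ∀ xs ys → (xs ∧ᴸ ys) ≼ ys
    lowerʳ []       ys       = []
    lowerʳ (x ∷ xs) []       = []
    lowerʳ (x ∷ xs) (y ∷ ys) = L.x∧y≤y x y ∷ lowerʳ xs ys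

    greatest : ∀ {xs ys zs} → zs ≼ xs → zs ≼ ys → zs ≼ (xs ∧ᴸ ys)
    greatest []       _        = []
    greatest (p ∷ ps) (q ∷ qs) = L.∧-greatest p q ∷ greatest ps qs

  ∧ᴸ-distribˡ-∨ᴸ : ∀ xs ys zs → (xs ∧ᴸ (ys ∨ᴸ zs)) ≡ ((xs ∧ᴸ ys) ∨ᴸ (xs ∧ᴸ zs))
  ∧ᴸ-distribˡ-∨ᴸ []       ys       zs       = refl
  ∧ᴸ-distribˡ-∨ᴸ (x ∷ xs) []       zs       = refl
  ∧ᴸ-distribˡ-∨ᴸ (x ∷ xs) (y ∷ ys) []       = refl
  ∧ᴸ-distribˡ-∨ᴸ (x ∷ xs) (y ∷ ys) (z ∷ zs) =
    cong₂ _∷_ (L.∧-distribˡ-∨ x y z) (∧ᴸ-distribˡ-∨ᴸ xs ys zs)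

  ≼-isDistributiveLattice : IsDistributiveLattice _≡_ _≼_ _∨ᴸ_ _∧ᴸ_
  ≼-isDistributiveLattice = record
    { isLattice = record
      { isPartialOrder = ≼-isPartialOrder
      ; supremum       = ≼-∨ᴸ-supremum
      ; infimum        = ≼-∧ᴸ-infimum
      }
    ; ∧-distribˡ-∨ = ∧ᴸ-distribˡ-∨ᴸ
    }

  All-∨ᴸ : {P : Pred A p} → (∀ {x y} → P x → P y → P (x ∨ y)) →
           ∀ {xs ys} → All P xs → All P ys → All P (xs ∨ᴸ ys)
  All-∨ᴸ P-∨ []       qs       = qs
  All-∨ᴸ P-∨ (p ∷ ps) []       = p ∷ ps
  All-∨ᴸ P-∨ (p ∷ ps) (q ∷ qs) = P-∨ p q ∷ All-∨ᴸ P-∨ ps qs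

  All-∧ᴸ : {P : Pred A p} → (∀ {x y} → P x → P y → P (x ∧ y)) →
           ∀ {xs ys} → All P xs → All P ys → All P (xs ∧ᴸ ys)
  All-∧ᴸ P-∧ []       _        = []
  All-∧ᴸ P-∧ (p ∷ ps) []       = []
  All-∧ᴸ P-∧ (p ∷ ps) (q ∷ qs) = P-∧ p q ∷ All-∧ᴸ P-∧ ps qs

module Sublattice {A : Set a} {_≤_ : Rel A ℓ} {_∨_ _∧_ : Op₂ A}
         (L : IsDistributiveLattice _≡_ _≤_ _∨_ _∧_)
         {P : Pred A p} (P-∨ : ∀ {x y} → P x → P y → P (x ∨ y))
         (P-∧ : ∀ {x y} → P x → P y → P (x ∧ y))
         {_≤′_ : Rel A ℓ′} (≤′⇒≤ : ∀ {x y} → x ≤′ y → x ≤ y)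
         (≤⇒≤′ : ∀ {x y} → x ≤ y → x ≤′ y) where

  private
    module L = IsDistributiveLattice L

  _∨ᴾ_ : Op₂ (Σ A P)
  x ∨ᴾ y = proj₁ x ∨ proj₁ y , P-∨ (proj₂ x) (proj₂ y)

  _∧ᴾ_ : Op₂ (Σ A P)
  x ∧ᴾ y = proj₁ x ∧ proj₁ y , P-∧ (proj₂ x) (proj₂ y)

  sublattice-isDistributiveLattice :
    IsDistributiveLattice (_≡_ on proj₁) (_≤′_ on proj₁) _∨ᴾ_ _∧ᴾ_
  sublattice-isDistributiveLattice = record
    { isLattice = record
      { isPartialOrder = record
        { isPreorder = record
          { isEquivalence = record { refl = refl ; sym = sym ; trans = trans }
          ; reflexive     = λ eq → ≤⇒≤′ (L.reflexive eq)
          ; trans         = λ p q → ≤⇒≤′ (L.trans (≤′⇒≤ p) (≤′⇒≤ q))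
          }
        ; antisym = λ p q → L.antisym (≤′⇒≤ p) (≤′⇒≤ q)
        }
      ; supremum = λ x y →
          ≤⇒≤′ (L.x≤x∨y _ _) , ≤⇒≤′ (L.y≤x∨y _ _) ,
          λ _ p q → ≤⇒≤′ (L.∨-least (≤′⇒≤ p) (≤′⇒≤ q))
      ; infimum = λ x y →
          ≤⇒≤′ (L.x∧y≤x _ _) , ≤⇒≤′ (L.x∧y≤y _ _) ,
          λ _ p q → ≤⇒≤′ (L.∧-greatest (≤′⇒≤ p) (≤′⇒≤ q))
      }
    ; ∧-distribˡ-∨ = λ x y z → L.∧-distribˡ-∨ (proj₁ x) (proj₁ y) (proj₁ z)
    }

open ListLattice ≤-⊔-⊓-isDistributiveLattice

-- _⊑_ on Sch is definitionally _≤ₚ_ on proj₁.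
_≤ₚ_ : List ℕ → List ℕ → Set
xs ≤ₚ ys = length xs ≤ length ys × (∀ i → i < length xs → part xs i ≤ part ys i)

≼⇒≤ₚ : ∀ {xs ys} → xs ≼ ys → xs ≤ₚ ys
≼⇒≤ₚ []       = z≤n , λ _ ()
≼⇒≤ₚ (p ∷ ps) = s≤s (proj₁ (≼⇒≤ₚ ps)) , λ
  { zero    _         → p
  ; (suc i) (s≤s i<n) → proj₂ (≼⇒≤ₚ ps) i i<n
  }

≤ₚ⇒≼ : ∀ {xs ys} → xs ≤ₚ ys → xs ≼ ys
≤ₚ⇒≼ {[]}                _                    = []
≤ₚ⇒≼ {x ∷ xs} {y ∷ ys} (s≤s n≤m , parts≤) =
  parts≤ 0 (s≤s z≤n) ∷ ≤ₚ⇒≼ (n≤m , λ i i<n → parts≤ (suc i) (s≤s i<n))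

SchroderStep : ℕ → ℕ → Set
SchroderStep a b = b ≤ a × (Odd a → b < a)

SchroderChain : List ℕ → Set
SchroderChain xs = Linked SchroderStep xs × All (0 <_) xs

step-trans : Transitive SchroderStep
step-trans (b≤a , b<a) (c≤b , _) = ≤-trans c≤b b≤a , λ o → ≤-<-trans c≤b (b<a o)

step-raise : ∀ {a a′ b} → a ≤ a′ → SchroderStep a b → SchroderStep a′ b
step-raise {a} {a′} {b} a≤a′ (b≤a , b<a) = ≤-trans b≤a a≤a′ , b<a′
  where
  b<a′ : Odd a′ → b < a′
  b<a′ o with m≤n⇒m<n∨m≡n a≤a′
  ... | inj₁ a<a′ = ≤-<-trans b≤a a<a′
  ... | inj₂ refl = b<a o

step-lower : ∀ {a b b′} → b′ ≤ b → SchroderStep a b → SchroderStep a b′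
step-lower b′≤b (b≤a , b<a) = ≤-trans b′≤b b≤a , λ o → ≤-<-trans b′≤b (b<a o)

step-⊔ʳ : ∀ {a b d} → SchroderStep a b → SchroderStep a d → SchroderStep a (b ⊔ d)
step-⊔ʳ (b≤a , b<a) (d≤a , d<a) = ⊔-lub b≤a d≤a , λ o → ⊔-lub (b<a o) (d<a o)

step-⊔ : ∀ {a b c d} → SchroderStep a b → SchroderStep c d →
         SchroderStep (a ⊔ c) (b ⊔ d)
step-⊔ {a} {c = c} s t =
  step-⊔ʳ (step-raise (m≤m⊔n a c) s) (step-raise (m≤n⊔m a c) t)

step-⊓ : ∀ {a b c d} → SchroderStep a b → SchroderStep c d →
         SchroderStep (a ⊓ c) (b ⊓ d)
step-⊓ {a} {b} {c} {d} s t with ⊓-sel a c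
... | inj₁ a⊓c≡a rewrite a⊓c≡a = step-lower (m⊓n≤m b d) s
... | inj₂ a⊓c≡c rewrite a⊓c≡c = step-lower (m⊓n≤n b d) t

Linked-step-∨ᴸ : ∀ {xs ys} → Linked SchroderStep xs → Linked SchroderStep ys →
                 Linked SchroderStep (xs ∨ᴸ ys)
Linked-step-∨ᴸ {[]}        {_}         _       q       = q
Linked-step-∨ᴸ {_ ∷ _}     {[]}        p       _       = p
Linked-step-∨ᴸ {_ ∷ []}    {_ ∷ []}    _       _       = [-]
Linked-step-∨ᴸ {x ∷ []}    {y ∷ _ ∷ _} [-]     (t ∷ q) = step-raise (m≤n⊔m x y) t ∷ q
Linked-step-∨ᴸ {x ∷ _ ∷ _} {y ∷ []}    (s ∷ p) [-]     = step-raise (m≤m⊔n x y) s ∷ p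
Linked-step-∨ᴸ {_ ∷ _ ∷ _} {_ ∷ _ ∷ _} (s ∷ p) (t ∷ q) = step-⊔ s t ∷ Linked-step-∨ᴸ p q

Linked-step-∧ᴸ : ∀ {xs ys} → Linked SchroderStep xs → Linked SchroderStep ys →
                 Linked SchroderStep (xs ∧ᴸ ys)
Linked-step-∧ᴸ {[]}        {_}         _       _       = []
Linked-step-∧ᴸ {_ ∷ _}     {[]}        _       _       = []
Linked-step-∧ᴸ {_ ∷ []}    {_ ∷ _}     _       _       = [-]
Linked-step-∧ᴸ {_ ∷ _ ∷ _} {_ ∷ []}    _       _       = [-]
Linked-step-∧ᴸ {_ ∷ _ ∷ _} {_ ∷ _ ∷ _} (s ∷ p) (t ∷ q) = step-⊓ s t ∷ Linked-step-∧ᴸ p q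

SchroderChain-∨ᴸ : ∀ {xs ys} → SchroderChain xs → SchroderChain ys → SchroderChain (xs ∨ᴸ ys)
SchroderChain-∨ᴸ (p , p⁺) (q , q⁺) =
  Linked-step-∨ᴸ p q , All-∨ᴸ (λ {x} {y} x⁺ _ → <-≤-trans x⁺ (m≤m⊔n x y)) p⁺ q⁺

SchroderChain-∧ᴸ : ∀ {xs ys} → SchroderChain xs → SchroderChain ys → SchroderChain (xs ∧ᴸ ys)
SchroderChain-∧ᴸ (p , p⁺) (q , q⁺) = Linked-step-∧ᴸ p q , All-∧ᴸ ⊓-glb p⁺ q⁺

mult-head : ∀ k xs → mult k (k ∷ xs) ≡ suc (mult k xs)
mult-head k xs = cong length (filter-accept (_≟ k) refl)

mult-skip : ∀ {k x} xs → x ≢ k → mult k (x ∷ xs) ≡ mult k xs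
mult-skip {k} xs x≢k = cong length (filter-reject (_≟ k) x≢k)

mult-∷ : ∀ k x xs → mult k xs ≤ mult k (x ∷ xs)
mult-∷ k x xs with x ≟ k
... | yes refl = ≤-trans (n≤1+n _) (≤-reflexive (sym (mult-head k xs)))
... | no  x≢k  = ≤-reflexive (sym (mult-skip xs x≢k))

odd-head-unrepeated : ∀ {k xs} → Odd k → Linked SchroderStep (k ∷ xs) → mult k xs ≡ 0
odd-head-unrepeated o [-]     = refl
odd-head-unrepeated o (s ∷ c) =
  cong length (filter-none (_≟ _) (All.map (λ t → <⇒≢ (proj₂ t o)) (Linked⇒All step-trans s c)))

stepLinked⇒mult≤1 : ∀ {xs} → Linked SchroderStep xs → ∀ k → Odd k → mult k xs ≤ 1
stepLinked⇒mult≤1 {[]}     _ k o = z≤n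
stepLinked⇒mult≤1 {x ∷ xs} c k o with x ≟ k
... | yes refl = ≤-reflexive (trans (mult-head k xs) (cong suc (odd-head-unrepeated o c)))
... | no  x≢k  = ≤-trans (≤-reflexive (mult-skip xs x≢k)) (stepLinked⇒mult≤1 (Linked.tail c) k o)

partition⇒stepLinked : ∀ {xs} → Linked (λ a b → b ≤ a) xs → (∀ k → Odd k → mult k xs ≤ 1) →
                  Linked SchroderStep xs
partition⇒stepLinked []  _ = []
partition⇒stepLinked [-] _ = [-]
partition⇒stepLinked {x ∷ y ∷ ys} (y≤x ∷ d) mult≤1 =
  (y≤x , y<x) ∷ partition⇒stepLinked d (λ k o → ≤-trans (mult-∷ k x (y ∷ ys)) (mult≤1 k o))
  where
  repeated : y ≡ x → 2 ≤ mult x (x ∷ y ∷ ys)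
  repeated refl rewrite mult-head y (y ∷ ys) | mult-head y ys = s≤s (s≤s z≤n)

  y<x : Odd x → y < x
  y<x o = ≤∧≢⇒< y≤x λ y≡x → <-irrefl refl (≤-trans (repeated y≡x) (mult≤1 x o))

IsSchroder⇒SchroderChain : ∀ {xs} → IsSchroder xs → SchroderChain xs
IsSchroder⇒SchroderChain ((d , xs⁺) , mult≤1) = partition⇒stepLinked d mult≤1 , xs⁺

SchroderChain⇒IsSchroder : ∀ {xs} → SchroderChain xs → IsSchroder xs
SchroderChain⇒IsSchroder (c , xs⁺) = (Linked.map proj₁ c , xs⁺) , stepLinked⇒mult≤1 c

IsSchroder-∨ᴸ : ∀ {xs ys} → IsSchroder xs → IsSchroder ys → IsSchroder (xs ∨ᴸ ys)
IsSchroder-∨ᴸ p q = SchroderChain⇒IsSchroder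
  (SchroderChain-∨ᴸ (IsSchroder⇒SchroderChain p) (IsSchroder⇒SchroderChain q))

IsSchroder-∧ᴸ : ∀ {xs ys} → IsSchroder xs → IsSchroder ys → IsSchroder (xs ∧ᴸ ys)
IsSchroder-∧ᴸ p q = SchroderChain⇒IsSchroder
  (SchroderChain-∧ᴸ (IsSchroder⇒SchroderChain p) (IsSchroder⇒SchroderChain q))

mainTheorem5 : ∃₂ λ (_∨_ : Sch → Sch → Sch) (_∧_ : Sch → Sch → Sch) →
    IsDistributiveLattice _≈ˢ_ _⊑_ _∨_ _∧_
mainTheorem5 = _∨ᴾ_ , _∧ᴾ_ , sublattice-isDistributiveLattice
  where open Sublattice ≼-isDistributiveLattice {P = IsSchroder} IsSchroder-∨ᴸ IsSchroder-∧ᴸ ≤ₚ⇒≼ ≼⇒≤ₚ
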